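{- Consider the RBB process with any $m \geq 1$ balls and $n$ bins. Then, for any round $t \geq 0$, \[ \mathbb{E}\big[ \Upsilon^{t+1} \,\big|\, \mathfrak{F}^t\big] \leq \Upsilon^t - 2 \cdot \frac{m}{n} \cdot F^t + 2n, \] where $\Upsilon^t := \sum_{i=1}^n (x_i^t)^2$ and $F^t$ is the number of empty bins at round $t$.
   Context: Repeated balls-into-bins (RBB) process: there are $n$ bins and $m$ balls, initially distributed arbitrarily; $x^t$ is the load vector after $t$ rounds. In each round $t$, let $\kappa^t = n - F^t$ be the number of non-empty bins in $x^t$; one ball is removed from each non-empty bin and each of these $\kappa^t$ balls is placed into a bin chosen independently and uniformly at random from $[n]$. $\mathfrak{F}^t$ denotes the history of the process up to round $t$. -}

module Defs where

open import Data.Nat using (ℕ; zero; suc; _+_; _*_; _∸_; _^_; NonZero)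
open import Data.Nat.Properties using (m^n≢0)
open import Data.Fin using (Fin; _≟_)
open import Data.Vec using (Vec; []; _∷_; lookup; tabulate)
import Data.Vec as Vec
open import Data.List using (List; [_]; concatMap; allFin)
import Data.List as List
open import Data.Integer using (+_)
open import Data.Nat.ListAction using () renaming (sum to sumℕ)
open import Data.Rational using (ℚ; _/_)
open import Relation.Nullary using (does)
open import Data.Bool using (if_then_else_)

-- Load vectors: x : Vec ℕ n, x_i = number of balls in bin i.

total : ∀ {n} → Vec ℕ n → ℕ
total = Vec.sum

Υ : ∀ {n} → Vec ℕ n → ℕ
Υ x = Vec.sum (Vec.map (λ a → a * a) x)

nonEmpty : ℕ → ℕ
nonEmpty zero    = 0
nonEmpty (suc _) = 1

empty : ℕ → ℕ
empty zero    = 1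
empty (suc _) = 0

κ : ∀ {n} → Vec ℕ n → ℕ
κ x = Vec.sum (Vec.map nonEmpty x)

F : ∀ {n} → Vec ℕ n → ℕ
F x = Vec.sum (Vec.map empty x)

hits : ∀ {n k} → Vec (Fin n) k → Fin n → ℕ
hits []       i = 0
hits (j ∷ cs) i = (if does (j ≟ i) then 1 else 0) + hits cs i

-- one RBB round from load vector x, given the destinations c of the κ(x)
-- removed balls (c_j = bin into which the j-th removed ball is placed)
step : ∀ {n} (x : Vec ℕ n) → Vec (Fin n) (κ x) → Vec ℕ n
step x c = tabulate (λ i → (lookup x i ∸ nonEmpty (lookup x i)) + hits c i)

-- all destination vectors in [n]^k (each equally likely, probability n^-k)
allChoices : (n k : ℕ) → List (Vec (Fin n) k)
allChoices n zero    = [ [] ]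
allChoices n (suc k) = concatMap (λ v → List.map (_∷ v) (allFin n)) (allChoices n k)

-- E[ Υ^{t+1} | x^t = x ] : the destinations are i.i.d. uniform on [n]
EΥnext : ∀ n .{{_ : NonZero n}} → Vec ℕ n → ℚ
EΥnext n x = _/_ (+ sumℕ (List.map (λ c → Υ (step x c)) (allChoices n (κ x))))
                 (n ^ κ x) {{m^n≢0 n (κ x)}}

module Submission where

-- After one ball is removed from every non-empty bin the loads are y i = x i ∸ [x i > 0], and the
-- κ = n − F removed balls are thrown independently and uniformly. Summing over all n^κ destination
-- vectors one ball at a time, a ball landing in bin j turns Σ z² into Σ z² + 2 z j + 1; this gives
-- exactly n · E[Υ'] = n Σ y² + 2κ Σ y + κ n + κ (κ − 1). With Σ y = m − κ, Σ y² = Υ − 2m + κ and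
-- κ = n − F this is E[Υ'] = Υ − 2mF/n + 2κ − κ(κ + 1)/n ≤ Υ − 2mF/n + 2n.

open import Defs
open import Data.Nat using (ℕ; zero; suc; _+_; _*_; _∸_; _^_; _≤_; _≥_; NonZero)
open import Data.Nat.Properties as ℕP using (+-identityʳ; *-identityʳ; m≤m+n; +-cancelʳ-≡; m^n≢0; m*n≢0)
open import Data.Nat.Tactic.RingSolver using (solve-∀)
open import Data.Nat.ListAction using () renaming (sum to sumᴸ)
open import Data.Nat.ListAction.Properties using (sum-++)
open import Algebra.Properties.Semiring.Sum ℕP.+-*-semiring using (sum; sum-syntax; sum-cong-≗; sum-replicate-zero; ∑-distrib-+; *-distribˡ-sum)
open import Data.Fin using (Fin; _≟_) renaming (zero to fzero; suc to fsuc)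
open import Data.Vec using (Vec; []; _∷_; lookup; tabulate)
import Data.Vec as Vec
open import Data.Vec.Properties using (tabulate-∘; map-id)
open import Data.List.Properties using (map-++; map-∘)
open import Data.List using (List; []; _∷_; concatMap; allFin)
import Data.List as List
open import Data.Integer as ℤ using (+_)
import Data.Integer.Properties as ℤP
open import Data.Rational as ℚ using (ℚ; _/_; Positive)
open import Data.Rational.Literals using (fromℤ)
open import Data.Rational.Properties
  using (↥p/↧p≡p; toℚᵘ-injective; toℚᵘ-homo-*; toℚᵘ-fromℚᵘ; normalize-pos; *-cancelʳ-≤-pos; +-monoˡ-≤)
import Data.Rational.Unnormalised as ℚᵘ
import Data.Rational.Unnormalised.Properties as ℚᵘP
open import Data.Rational.Solver using (module +-*-Solver)
open import Data.Bool using (if_then_else_)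
open import Relation.Nullary using (does)
open import Relation.Binary.PropositionalEquality
open ≡-Reasoning

sum-const : ∀ n c → ∑[ i < n ] c ≡ n * c
sum-const zero    c = refl
sum-const (suc n) c = cong (_+_ c) (sum-const n c)

sum² : ∀ {n} → (Fin n → ℕ) → ℕ
sum² {n} f = ∑[ i < n ] (f i * f i)

sum-tabulate : ∀ {n} (f : Fin n → ℕ) → Vec.sum (tabulate f) ≡ sum f
sum-tabulate {zero}  f = refl
sum-tabulate {suc n} f = cong (_+_ (f fzero)) (sum-tabulate (λ i → f (fsuc i)))

sum-map-lookup : ∀ {n} (f : ℕ → ℕ) (xs : Vec ℕ n) → Vec.sum (Vec.map f xs) ≡ ∑[ i < n ] f (lookup xs i)
sum-map-lookup f []       = refl
sum-map-lookup f (a ∷ xs) = cong (_+_ (f a)) (sum-map-lookup f xs)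

-- δ j i is literally the summand of hits, so hits (j ∷ c) i reduces to δ j i + hits c i.
δ : ∀ {n} → Fin n → Fin n → ℕ
δ j i = if does (j ≟ i) then 1 else 0

sum-δ-* : ∀ {n} (j : Fin n) (w : Fin n → ℕ) → ∑[ i < n ] (δ j i * w i) ≡ w j
sum-δ-* {suc n} fzero    w = begin
  w fzero + 0 + ∑[ i < n ] 0 ≡⟨ cong (_+_ (w fzero + 0)) (sum-replicate-zero n) ⟩
  w fzero + 0 + 0            ≡⟨ trans (+-identityʳ _) (+-identityʳ _) ⟩
  w fzero                    ∎
sum-δ-* {suc n} (fsuc j) w = sum-δ-* j (λ i → w (fsuc i))

δ-diag : ∀ {n} (j : Fin n) → δ j j ≡ 1
δ-diag fzero    = refl
δ-diag (fsuc j) = δ-diag j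

sum-δ : ∀ {n} (j : Fin n) → sum (δ j) ≡ 1
sum-δ j = trans (sum-cong-≗ (λ i → sym (*-identityʳ (δ j i)))) (sum-δ-* j (λ _ → 1))

module _ {A : Set} where

  sum-map-cong : ∀ {f g : A → ℕ} → (∀ a → f a ≡ g a) → ∀ xs → sumᴸ (List.map f xs) ≡ sumᴸ (List.map g xs)
  sum-map-cong f≗g []       = refl
  sum-map-cong f≗g (a ∷ xs) = cong₂ _+_ (f≗g a) (sum-map-cong f≗g xs)

  sum-map-+ : ∀ (f g : A → ℕ) xs →
    sumᴸ (List.map (λ a → f a + g a) xs) ≡ sumᴸ (List.map f xs) + sumᴸ (List.map g xs)
  sum-map-+ f g []       = refl
  sum-map-+ f g (a ∷ xs) = trans (cong (_+_ (f a + g a)) (sum-map-+ f g xs)) (interchange (f a) (g a) _ _)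
    where
    interchange : ∀ p q r s → p + q + (r + s) ≡ p + r + (q + s)
    interchange = solve-∀

  sum-map-*ˡ : ∀ c (f : A → ℕ) xs → sumᴸ (List.map (λ a → c * f a) xs) ≡ c * sumᴸ (List.map f xs)
  sum-map-*ˡ c f []       = sym (ℕP.*-zeroʳ c)
  sum-map-*ˡ c f (a ∷ xs) = trans (cong (_+_ (c * f a)) (sum-map-*ˡ c f xs)) (sym (ℕP.*-distribˡ-+ c (f a) _))

  sum-map-tabulate : ∀ {n} (f : A → ℕ) (g : Fin n → A) → sumᴸ (List.map f (List.tabulate g)) ≡ ∑[ i < n ] f (g i)
  sum-map-tabulate {zero}  f g = refl
  sum-map-tabulate {suc n} f g = cong (_+_ (f (g fzero))) (sum-map-tabulate f (λ i → g (fsuc i)))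

  sum-map-concatMap : ∀ {B : Set} (f : B → ℕ) (h : A → List B) xs →
    sumᴸ (List.map f (concatMap h xs)) ≡ sumᴸ (List.map (λ a → sumᴸ (List.map f (h a))) xs)
  sum-map-concatMap f h []       = refl
  sum-map-concatMap f h (a ∷ xs) = begin
    sumᴸ (List.map f (h a List.++ concatMap h xs))
      ≡⟨ cong sumᴸ (map-++ f (h a) (concatMap h xs)) ⟩
    sumᴸ (List.map f (h a) List.++ List.map f (concatMap h xs))
      ≡⟨ sum-++ (List.map f (h a)) _ ⟩
    sumᴸ (List.map f (h a)) + sumᴸ (List.map f (concatMap h xs))
      ≡⟨ cong (_+_ (sumᴸ (List.map f (h a)))) (sum-map-concatMap f h xs) ⟩
    sumᴸ (List.map f (h a)) + sumᴸ (List.map (λ a → sumᴸ (List.map f (h a))) xs) ∎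

module _ (n : ℕ) where

  -- n ^ k times the expectation of Φ under k independent uniform destinations.
  sumChoices : ∀ k → (Vec (Fin n) k → ℕ) → ℕ
  sumChoices k Φ = sumᴸ (List.map Φ (allChoices n k))

  sumChoices-cong : ∀ k {Φ Ψ : Vec (Fin n) k → ℕ} → (∀ c → Φ c ≡ Ψ c) → sumChoices k Φ ≡ sumChoices k Ψ
  sumChoices-cong k Φ≗Ψ = sum-map-cong Φ≗Ψ (allChoices n k)

  sumChoices-suc : ∀ k (Φ : Vec (Fin n) (suc k) → ℕ) →
    sumChoices (suc k) Φ ≡ sumChoices k (λ c → ∑[ j < n ] Φ (j ∷ c))
  sumChoices-suc k Φ = trans (sum-map-concatMap Φ _ (allChoices n k)) (sumChoices-cong k λ c →
    trans (cong sumᴸ (sym (map-∘ (allFin n)))) (sum-map-tabulate (λ j → Φ (j ∷ c)) (λ j → j)))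

  sumChoices-+ : ∀ k (Φ Ψ : Vec (Fin n) k → ℕ) →
    sumChoices k (λ c → Φ c + Ψ c) ≡ sumChoices k Φ + sumChoices k Ψ
  sumChoices-+ k Φ Ψ = sum-map-+ Φ Ψ (allChoices n k)

  sumChoices-*ˡ : ∀ k a (Φ : Vec (Fin n) k → ℕ) → sumChoices k (λ c → a * Φ c) ≡ a * sumChoices k Φ
  sumChoices-*ˡ k a Φ = sum-map-*ˡ a Φ (allChoices n k)

  sumChoices-const : ∀ k a → sumChoices k (λ _ → a) ≡ n ^ k * a
  sumChoices-const zero    a = trans (+-identityʳ a) (sym (ℕP.*-identityˡ a))
  sumChoices-const (suc k) a = begin
    sumChoices (suc k) (λ _ → a)      ≡⟨ sumChoices-suc k (λ _ → a) ⟩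
    sumChoices k (λ _ → ∑[ j < n ] a) ≡⟨ sumChoices-cong k (λ _ → sum-const n a) ⟩
    sumChoices k (λ _ → n * a)        ≡⟨ sumChoices-const k (n * a) ⟩
    n ^ k * (n * a)                   ≡⟨ sym (ℕP.*-assoc (n ^ k) n a) ⟩
    n ^ k * n * a                     ≡⟨ cong (_* a) (ℕP.*-comm (n ^ k) n) ⟩
    n * n ^ k * a                     ∎

module _ {n : ℕ} (y : Fin n → ℕ) where

  load : ∀ {k} → Vec (Fin n) k → Fin n → ℕ
  load c i = y i + hits c i

  sum-load-∷ : ∀ {k} (j : Fin n) (c : Vec (Fin n) k) → sum (load (j ∷ c)) ≡ sum (load c) + 1
  sum-load-∷ j c = begin
    sum (load (j ∷ c))                 ≡⟨ sum-cong-≗ (λ i → shift (y i) (δ j i) (hits c i)) ⟩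
    ∑[ i < n ] (load c i + δ j i)      ≡⟨ ∑-distrib-+ (load c) (δ j) ⟩
    sum (load c) + sum (δ j)           ≡⟨ cong (_+_ (sum (load c))) (sum-δ j) ⟩
    sum (load c) + 1                   ∎
    where
    shift : ∀ a d h → a + (d + h) ≡ a + h + d
    shift = solve-∀

  sum-load²-∷ : ∀ {k} (j : Fin n) (c : Vec (Fin n) k) →
    sum² (load (j ∷ c)) ≡ sum² (load c) + 2 * load c j + 1
  sum-load²-∷ j c = begin
    sum² (load (j ∷ c))
      ≡⟨ sum-cong-≗ (λ i → expand (y i) (δ j i) (hits c i)) ⟩
    ∑[ i < n ] (load c i * load c i + 2 * (δ j i * load c i) + δ j i * δ j i)
      ≡⟨ ∑-distrib-+ {n} _ _ ⟩
    ∑[ i < n ] (load c i * load c i + 2 * (δ j i * load c i)) + ∑[ i < n ] (δ j i * δ j i)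
      ≡⟨ cong₂ _+_ (∑-distrib-+ {n} _ _) (trans (sum-δ-* j (δ j)) (δ-diag j)) ⟩
    sum² (load c) + ∑[ i < n ] (2 * (δ j i * load c i)) + 1
      ≡⟨ cong (λ s → sum² (load c) + s + 1)
              (trans (sym (*-distribˡ-sum {n} 2 _)) (cong (2 *_) (sum-δ-* j (load c)))) ⟩
    sum² (load c) + 2 * load c j + 1 ∎
    where
    expand : ∀ a d h → (a + (d + h)) * (a + (d + h)) ≡ (a + h) * (a + h) + 2 * (d * (a + h)) + d * d
    expand = solve-∀

  ∑-sum-load-∷ : ∀ {k} (c : Vec (Fin n) k) → ∑[ j < n ] sum (load (j ∷ c)) ≡ n * sum (load c) + n
  ∑-sum-load-∷ c = begin
    ∑[ j < n ] sum (load (j ∷ c))        ≡⟨ sum-cong-≗ (λ j → sum-load-∷ j c) ⟩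
    ∑[ j < n ] (sum (load c) + 1)        ≡⟨ ∑-distrib-+ {n} _ _ ⟩
    ∑[ j < n ] sum (load c) + ∑[ j < n ] 1
      ≡⟨ cong₂ _+_ (sum-const n _) (trans (sum-const n 1) (*-identityʳ n)) ⟩
    n * sum (load c) + n                 ∎

  ∑-sum²-load-∷ : ∀ {k} (c : Vec (Fin n) k) →
    ∑[ j < n ] sum² (load (j ∷ c)) ≡ n * sum² (load c) + 2 * sum (load c) + n
  ∑-sum²-load-∷ c = begin
    ∑[ j < n ] sum² (load (j ∷ c))                        ≡⟨ sum-cong-≗ (λ j → sum-load²-∷ j c) ⟩
    ∑[ j < n ] (sum² (load c) + 2 * load c j + 1)         ≡⟨ ∑-distrib-+ {n} _ _ ⟩
    ∑[ j < n ] (sum² (load c) + 2 * load c j) + ∑[ j < n ] 1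
      ≡⟨ cong₂ _+_ (∑-distrib-+ {n} _ _) (trans (sum-const n 1) (*-identityʳ n)) ⟩
    ∑[ j < n ] sum² (load c) + ∑[ j < n ] (2 * load c j) + n
      ≡⟨ cong₂ (λ a b → a + b + n) (sum-const n _) (sym (*-distribˡ-sum {n} 2 (load c))) ⟩
    n * sum² (load c) + 2 * sum (load c) + n              ∎

  firstMoment : ∀ k → sumChoices n k (λ c → sum (load c)) ≡ n ^ k * (sum y + k)
  firstMoment zero = begin
    sum (load []) + 0   ≡⟨ +-identityʳ _ ⟩
    sum (load [])       ≡⟨ sum-cong-≗ (λ i → +-identityʳ (y i)) ⟩
    sum y               ≡⟨ sym (trans (ℕP.*-identityˡ _) (+-identityʳ _)) ⟩
    1 * (sum y + 0)     ∎
  firstMoment (suc k) = begin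
    sumChoices n (suc k) (λ c → sum (load c))
      ≡⟨ sumChoices-suc n k _ ⟩
    sumChoices n k (λ c → ∑[ j < n ] sum (load (j ∷ c)))
      ≡⟨ sumChoices-cong n k ∑-sum-load-∷ ⟩
    sumChoices n k (λ c → n * sum (load c) + n)
      ≡⟨ sumChoices-+ n k _ _ ⟩
    sumChoices n k (λ c → n * sum (load c)) + sumChoices n k (λ _ → n)
      ≡⟨ cong₂ _+_ (sumChoices-*ˡ n k n _) (sumChoices-const n k n) ⟩
    n * sumChoices n k (λ c → sum (load c)) + n ^ k * n
      ≡⟨ cong (λ s → n * s + n ^ k * n) (firstMoment k) ⟩
    n * (n ^ k * (sum y + k)) + n ^ k * n
      ≡⟨ regroup n (n ^ k) (sum y) k ⟩
    n * n ^ k * (sum y + suc k) ∎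
    where
    regroup : ∀ n N L k → n * (N * (L + k)) + N * n ≡ n * N * (L + suc k)
    regroup = solve-∀

  secondMoment-suc : ∀ k → sumChoices n (suc k) (λ c → sum² (load c))
    ≡ n * sumChoices n k (λ c → sum² (load c)) + 2 * sumChoices n k (λ c → sum (load c)) + n ^ k * n
  secondMoment-suc k = begin
    sumChoices n (suc k) (λ c → sum² (load c))
      ≡⟨ sumChoices-suc n k _ ⟩
    sumChoices n k (λ c → ∑[ j < n ] sum² (load (j ∷ c)))
      ≡⟨ sumChoices-cong n k ∑-sum²-load-∷ ⟩
    sumChoices n k (λ c → n * sum² (load c) + 2 * sum (load c) + n)
      ≡⟨ sumChoices-+ n k _ _ ⟩
    sumChoices n k (λ c → n * sum² (load c) + 2 * sum (load c)) + sumChoices n k (λ _ → n)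
      ≡⟨ cong₂ _+_ (sumChoices-+ n k _ _) (sumChoices-const n k n) ⟩
    sumChoices n k (λ c → n * sum² (load c)) + sumChoices n k (λ c → 2 * sum (load c)) + n ^ k * n
      ≡⟨ cong₂ (λ a b → a + b + n ^ k * n) (sumChoices-*ˡ n k n _) (sumChoices-*ˡ n k 2 _) ⟩
    n * sumChoices n k (λ c → sum² (load c)) + 2 * sumChoices n k (λ c → sum (load c)) + n ^ k * n ∎

  -- n^k·k is added on the left because the right-hand side would otherwise contain k(k − 1).
  secondMoment : ∀ k → n * sumChoices n k (λ c → sum² (load c)) + n ^ k * k
    ≡ n ^ k * (n * sum² y + 2 * k * sum y + k * n + k * k)
  secondMoment zero = begin
    n * (sum² (load []) + 0) + 1 * 0
      ≡⟨ cong (λ s → n * (s + 0) + 1 * 0)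
              (sum-cong-≗ (λ i → cong₂ _*_ (+-identityʳ (y i)) (+-identityʳ (y i)))) ⟩
    n * (sum² y + 0) + 1 * 0
      ≡⟨ regroup n (sum² y) (sum y) ⟩
    1 * (n * sum² y + 2 * 0 * sum y + 0 * n + 0 * 0) ∎
    where
    regroup : ∀ n Q L → n * (Q + 0) + 1 * 0 ≡ 1 * (n * Q + 2 * 0 * L + 0 * n + 0 * 0)
    regroup = solve-∀
  secondMoment (suc k) = begin
    n * S (suc k) + n * n ^ k * suc k
      ≡⟨ cong (λ s → n * s + n * n ^ k * suc k) (secondMoment-suc k) ⟩
    n * (n * S k + 2 * M k + n ^ k * n) + n * n ^ k * suc k
      ≡⟨ cong (λ s → n * (n * S k + 2 * s + n ^ k * n) + n * n ^ k * suc k) (firstMoment k) ⟩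
    n * (n * S k + 2 * (n ^ k * (sum y + k)) + n ^ k * n) + n * n ^ k * suc k
      ≡⟨ split n (S k) (n ^ k) (sum y) k ⟩
    n * (n * S k + n ^ k * k) + n * (2 * (n ^ k * (sum y + k)) + n ^ k * n + n ^ k)
      ≡⟨ cong (λ s → n * s + n * (2 * (n ^ k * (sum y + k)) + n ^ k * n + n ^ k)) (secondMoment k) ⟩
    n * (n ^ k * (n * sum² y + 2 * k * sum y + k * n + k * k)) + n * (2 * (n ^ k * (sum y + k)) + n ^ k * n + n ^ k)
      ≡⟨ merge n (n ^ k) (sum² y) (sum y) k ⟩
    n * n ^ k * (n * sum² y + 2 * suc k * sum y + suc k * n + suc k * suc k) ∎
    where
    S M : ∀ k → ℕ
    S k = sumChoices n k (λ c → sum² (load c))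
    M k = sumChoices n k (λ c → sum (load c))
    split : ∀ n T N L k → n * (n * T + 2 * (N * (L + k)) + N * n) + n * N * suc k
                        ≡ n * (n * T + N * k) + n * (2 * (N * (L + k)) + N * n + N)
    split = solve-∀
    merge : ∀ n N Q L k → n * (N * (n * Q + 2 * k * L + k * n + k * k)) + n * (2 * (N * (L + k)) + N * n + N)
                        ≡ n * N * (n * Q + 2 * suc k * L + suc k * n + suc k * suc k)
    merge = solve-∀

∸nonEmpty+nonEmpty : ∀ a → a ∸ nonEmpty a + nonEmpty a ≡ a
∸nonEmpty+nonEmpty zero    = refl
∸nonEmpty+nonEmpty (suc a) = ℕP.+-comm a 1

square-∸nonEmpty : ∀ a → a * a ≡ (a ∸ nonEmpty a) * (a ∸ nonEmpty a) + 2 * (a ∸ nonEmpty a) + nonEmpty a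
square-∸nonEmpty zero    = refl
square-∸nonEmpty (suc a) = expand a
  where
  expand : ∀ a → suc a * suc a ≡ a * a + 2 * a + 1
  expand = solve-∀

empty+nonEmpty : ∀ a → empty a + nonEmpty a ≡ 1
empty+nonEmpty zero    = refl
empty+nonEmpty (suc a) = refl

module _ {n : ℕ} (x : Vec ℕ n) where

  afterRemoval : Fin n → ℕ
  afterRemoval i = lookup x i ∸ nonEmpty (lookup x i)

  κ≡sum : κ x ≡ ∑[ i < n ] nonEmpty (lookup x i)
  κ≡sum = sum-map-lookup nonEmpty x

  total≡sum+κ : total x ≡ sum afterRemoval + κ x
  total≡sum+κ = begin
    total x                                      ≡⟨ cong Vec.sum (sym (map-id x)) ⟩
    Vec.sum (Vec.map (λ a → a) x)                ≡⟨ sum-map-lookup (λ a → a) x ⟩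
    sum (lookup x)                               ≡⟨ sum-cong-≗ (λ i → sym (∸nonEmpty+nonEmpty (lookup x i))) ⟩
    ∑[ i < n ] (afterRemoval i + nonEmpty (lookup x i)) ≡⟨ ∑-distrib-+ {n} _ _ ⟩
    sum afterRemoval + ∑[ i < n ] nonEmpty (lookup x i) ≡⟨ cong (_+_ (sum afterRemoval)) (sym κ≡sum) ⟩
    sum afterRemoval + κ x                       ∎

  Υ≡sum²+2sum+κ : Υ x ≡ sum² afterRemoval + 2 * sum afterRemoval + κ x
  Υ≡sum²+2sum+κ = begin
    Υ x                                          ≡⟨ sum-map-lookup (λ a → a * a) x ⟩
    ∑[ i < n ] (lookup x i * lookup x i)         ≡⟨ sum-cong-≗ (λ i → square-∸nonEmpty (lookup x i)) ⟩
    ∑[ i < n ] (afterRemoval i * afterRemoval i + 2 * afterRemoval i + nonEmpty (lookup x i))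
      ≡⟨ ∑-distrib-+ {n} _ _ ⟩
    ∑[ i < n ] (afterRemoval i * afterRemoval i + 2 * afterRemoval i) + ∑[ i < n ] nonEmpty (lookup x i)
      ≡⟨ cong₂ _+_ (∑-distrib-+ {n} _ _) (sym κ≡sum) ⟩
    sum² afterRemoval + ∑[ i < n ] (2 * afterRemoval i) + κ x
      ≡⟨ cong (λ s → sum² afterRemoval + s + κ x) (sym (*-distribˡ-sum {n} 2 afterRemoval)) ⟩
    sum² afterRemoval + 2 * sum afterRemoval + κ x ∎

  n≡F+κ : n ≡ F x + κ x
  n≡F+κ = begin
    n                                            ≡⟨ sym (*-identityʳ n) ⟩
    n * 1                                        ≡⟨ sym (sum-const n 1) ⟩
    ∑[ i < n ] 1                                 ≡⟨ sum-cong-≗ (λ i → sym (empty+nonEmpty (lookup x i))) ⟩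
    ∑[ i < n ] (empty (lookup x i) + nonEmpty (lookup x i)) ≡⟨ ∑-distrib-+ {n} _ _ ⟩
    ∑[ i < n ] empty (lookup x i) + ∑[ i < n ] nonEmpty (lookup x i)
      ≡⟨ sym (cong₂ _+_ (sum-map-lookup empty x) κ≡sum) ⟩
    F x + κ x                                    ∎

  Υ∘step≡sum²∘load : (c : Vec (Fin n) (κ x)) → Υ (step x c) ≡ sum² (load afterRemoval c)
  Υ∘step≡sum²∘load c = trans (cong Vec.sum (sym (tabulate-∘ (λ a → a * a) (load afterRemoval c))))
                             (sum-tabulate (λ i → load afterRemoval c i * load afterRemoval c i))

numerator-bound : ∀ {n m Y F k L Q T N} → n ≡ F + k → m ≡ L + k → Y ≡ Q + 2 * L + k →
  n * T + N * k ≡ N * (n * Q + 2 * k * L + k * n + k * k) →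
  T * n + 2 * m * F * N ≤ (Y + 2 * n) * (N * n)
numerator-bound {F = F} {k} {L} {Q} {T} {N} refl refl refl moment =
  ℕP.≤-trans (m≤m+n (T * n + R) (N * slack)) (ℕP.≤-reflexive (sym (+-cancelʳ-≡ (N * k) _ _ balance)))
  where
  n m Y R slack : ℕ
  n = F + k
  m = L + k
  Y = Q + 2 * L + k
  R = 2 * m * F * N
  slack = k + k * k + 2 * F * k + 2 * F * F
  balance : (Y + 2 * n) * (N * n) + N * k ≡ T * n + R + N * slack + N * k
  balance = begin
    (Y + 2 * n) * (N * n) + N * k                             ≡⟨ expand F k L Q N ⟩
    N * (n * Q + 2 * k * L + k * n + k * k) + (R + N * slack) ≡⟨ cong (_+ (R + N * slack)) moment ⟨
    n * T + N * k + (R + N * slack)                           ≡⟨ regroup F k T N R (N * slack) ⟩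
    T * n + R + N * slack + N * k                             ∎
    where
    expand : ∀ F k L Q N →
      (Q + 2 * L + k + 2 * (F + k)) * (N * (F + k)) + N * k
        ≡ N * ((F + k) * Q + 2 * k * L + k * (F + k) + k * k)
          + (2 * (L + k) * F * N + N * (k + k * k + 2 * F * k + 2 * F * F))
    expand = solve-∀
    regroup : ∀ F k T N R S → (F + k) * T + N * k + (R + S) ≡ T * (F + k) + R + S + N * k
    regroup = solve-∀

fromℕ : ℕ → ℚ
fromℕ a = + a / 1

fromℕ≡fromℤ : ∀ a → fromℕ a ≡ fromℤ (+ a)
fromℕ≡fromℤ a = ↥p/↧p≡p (fromℤ (+ a))

fromℕ-+ : ∀ a b → fromℕ (a + b) ≡ fromℕ a ℚ.+ fromℕ b
fromℕ-+ a b = begin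
  fromℕ (a + b)
    ≡⟨ cong (λ i → i / 1) (cong₂ ℤ._+_ (sym (ℤP.*-identityʳ (+ a))) (sym (ℤP.*-identityʳ (+ b)))) ⟩
  (+ a ℤ.* + 1 ℤ.+ + b ℤ.* + 1) / 1   ≡⟨⟩
  fromℤ (+ a) ℚ.+ fromℤ (+ b)         ≡⟨ cong₂ ℚ._+_ (fromℕ≡fromℤ a) (fromℕ≡fromℤ b) ⟨
  fromℕ a ℚ.+ fromℕ b                 ∎

fromℕ-* : ∀ a b → fromℕ (a * b) ≡ fromℕ a ℚ.* fromℕ b
fromℕ-* a b = begin
  fromℕ (a * b)                ≡⟨ cong (λ i → i / 1) (ℤP.pos-* a b) ⟩
  (+ a ℤ.* + b) / 1            ≡⟨⟩
  fromℤ (+ a) ℚ.* fromℤ (+ b)  ≡⟨ cong₂ ℚ._*_ (fromℕ≡fromℤ a) (fromℕ≡fromℤ b) ⟨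
  fromℕ a ℚ.* fromℕ b          ∎

fromℕ-mono-≤ : ∀ {a b} → a ≤ b → fromℕ a ℚ.≤ fromℕ b
fromℕ-mono-≤ {a} {b} a≤b = subst₂ ℚ._≤_ (sym (fromℕ≡fromℤ a)) (sym (fromℕ≡fromℤ b))
  (ℚ.*≤* (ℤP.*-monoʳ-≤-nonNeg (+ 1) (ℤ.+≤+ a≤b)))

/-*-cancel : ∀ a q .{{_ : NonZero q}} → (+ a / q) ℚ.* fromℕ q ≡ fromℕ a
/-*-cancel a (suc d) = toℚᵘ-injective
  (ℚᵘP.≃-trans (toℚᵘ-homo-* (+ a / suc d) (fromℕ (suc d)))
  (ℚᵘP.≃-trans (ℚᵘP.*-cong (toℚᵘ-fromℚᵘ (ℚᵘ.mkℚᵘ (+ a) d)) (toℚᵘ-fromℚᵘ (ℚᵘ.mkℚᵘ (+ suc d) 0)))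
  (ℚᵘP.≃-trans (ℚᵘ.*≡* cross) (ℚᵘP.≃-sym (toℚᵘ-fromℚᵘ (ℚᵘ.mkℚᵘ (+ a) 0))))))
  where
  cross : (+ a ℤ.* + suc d) ℤ.* + 1 ≡ + a ℤ.* + (suc d * 1)
  cross = trans (ℤP.*-identityʳ _) (cong (λ w → + a ℤ.* + w) (sym (*-identityʳ (suc d))))

clear-denominators : ∀ T N n m F Y .{{_ : NonZero N}} .{{_ : NonZero n}} →
  T * n + 2 * m * F * N ≤ (Y + 2 * n) * (N * n) →
  + T / N ℚ.≤ (fromℕ Y ℚ.- fromℕ 2 ℚ.* (+ m / n) ℚ.* fromℕ F) ℚ.+ fromℕ 2 ℚ.* fromℕ n
clear-denominators T N n m F Y bound =
  subst₂ ℚ._≤_ (p+q-q≡p u X) (p+r-q≡p-q+r (fromℕ Y) X (fromℕ 2 ℚ.* fromℕ n)) (+-monoˡ-≤ (ℚ.- X) u+X≤W)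
  where
  open +-*-Solver
  instance
    _ : NonZero (N * n)
    _ = m*n≢0 N n
  u X W r : ℚ
  u = + T / N
  X = fromℕ 2 ℚ.* (+ m / n) ℚ.* fromℕ F
  W = fromℕ Y ℚ.+ fromℕ 2 ℚ.* fromℕ n
  r = fromℕ (N * n)
  instance
    _ : Positive r
    _ = normalize-pos (N * n) 1
  p+q-q≡p : ∀ p q → p ℚ.+ q ℚ.- q ≡ p
  p+q-q≡p = solve 2 (λ p q → p :+ q :- q := p) refl
  p+r-q≡p-q+r : ∀ p q r → p ℚ.+ r ℚ.- q ≡ p ℚ.- q ℚ.+ r
  p+r-q≡p-q+r = solve 3 (λ p q r → p :+ r :- q := p :- q :+ r) refl
  distribute : ∀ u t v F N n → (u ℚ.+ t ℚ.* v ℚ.* F) ℚ.* (N ℚ.* n) ≡ u ℚ.* N ℚ.* n ℚ.+ t ℚ.* (v ℚ.* n) ℚ.* F ℚ.* N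
  distribute = solve 6 (λ u t v F N n → (u :+ t :* v :* F) :* (N :* n) := u :* N :* n :+ t :* (v :* n) :* F :* N) refl
  fromℕ-*⁴ : ∀ a b c d → fromℕ (a * b * c * d) ≡ fromℕ a ℚ.* fromℕ b ℚ.* fromℕ c ℚ.* fromℕ d
  fromℕ-*⁴ a b c d = trans (fromℕ-* (a * b * c) d)
    (cong (ℚ._* fromℕ d) (trans (fromℕ-* (a * b) c) (cong (ℚ._* fromℕ c) (fromℕ-* a b))))
  lhs : (u ℚ.+ X) ℚ.* r ≡ fromℕ (T * n + 2 * m * F * N)
  lhs = begin
    (u ℚ.+ X) ℚ.* r
      ≡⟨ cong (ℚ._*_ (u ℚ.+ X)) (fromℕ-* N n) ⟩
    (u ℚ.+ X) ℚ.* (fromℕ N ℚ.* fromℕ n)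
      ≡⟨ distribute u (fromℕ 2) (+ m / n) (fromℕ F) (fromℕ N) (fromℕ n) ⟩
    u ℚ.* fromℕ N ℚ.* fromℕ n ℚ.+ fromℕ 2 ℚ.* ((+ m / n) ℚ.* fromℕ n) ℚ.* fromℕ F ℚ.* fromℕ N
      ≡⟨ cong₂ (λ p q → p ℚ.* fromℕ n ℚ.+ fromℕ 2 ℚ.* q ℚ.* fromℕ F ℚ.* fromℕ N) (/-*-cancel T N) (/-*-cancel m n) ⟩
    fromℕ T ℚ.* fromℕ n ℚ.+ fromℕ 2 ℚ.* fromℕ m ℚ.* fromℕ F ℚ.* fromℕ N
      ≡⟨ cong₂ ℚ._+_ (fromℕ-* T n) (fromℕ-*⁴ 2 m F N) ⟨
    fromℕ (T * n) ℚ.+ fromℕ (2 * m * F * N)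
      ≡⟨ fromℕ-+ (T * n) (2 * m * F * N) ⟨
    fromℕ (T * n + 2 * m * F * N) ∎
  rhs : W ℚ.* r ≡ fromℕ ((Y + 2 * n) * (N * n))
  rhs = sym (begin
    fromℕ ((Y + 2 * n) * (N * n))                  ≡⟨ fromℕ-* (Y + 2 * n) (N * n) ⟩
    fromℕ (Y + 2 * n) ℚ.* r                        ≡⟨ cong (ℚ._* r) (fromℕ-+ Y (2 * n)) ⟩
    (fromℕ Y ℚ.+ fromℕ (2 * n)) ℚ.* r              ≡⟨ cong (λ q → (fromℕ Y ℚ.+ q) ℚ.* r) (fromℕ-* 2 n) ⟩
    (fromℕ Y ℚ.+ fromℕ 2 ℚ.* fromℕ n) ℚ.* r        ∎)
  u+X≤W : u ℚ.+ X ℚ.≤ W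
  u+X≤W = *-cancelʳ-≤-pos r (subst₂ ℚ._≤_ (sym lhs) (sym rhs) (fromℕ-mono-≤ bound))

lemma3p1 : (n m : ℕ) .{{_ : NonZero n}} → m ≥ 1 → (x : Vec ℕ n) → total x ≡ m →
    EΥnext n x ℚ.≤ ((+ Υ x / 1) ℚ.- (+ 2 / 1) ℚ.* (+ m / n) ℚ.* (+ F x / 1)) ℚ.+ (+ 2 / 1) ℚ.* (+ n / 1)
lemma3p1 n m _ x refl =
  clear-denominators T (n ^ κ x) n (total x) (F x) (Υ x) {{m^n≢0 n (κ x)}}
    (numerator-bound (n≡F+κ x) (total≡sum+κ x) (Υ≡sum²+2sum+κ x) moment)
  where
  T : ℕ
  T = sumChoices n (κ x) (λ c → Υ (step x c))
  moment : n * T + n ^ κ x * κ x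
         ≡ n ^ κ x * (n * sum² (afterRemoval x) + 2 * κ x * sum (afterRemoval x) + κ x * n + κ x * κ x)
  moment = trans (cong (λ s → n * s + n ^ κ x * κ x) (sumChoices-cong n (κ x) (Υ∘step≡sum²∘load x)))
                 (secondMoment (afterRemoval x) (κ x))
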